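{- Suppose a rule instance of $(+,+)$, $(\oplus,+)$ or $(+,\oplus)$ of the formal system for compliance has premises $\Gamma,\rho\dashv\sigma\rhd\rho_i\dashv\sigma_i$ for $i=1,\dots,n$ and conclusion $\Gamma\rhd\rho\dashv\sigma$. Then for all histories $\vec\delta,\vec\gamma$ and all $i=1,\dots,n$ there exist histories $\vec\delta_i,\vec\gamma_i$ such that $\langle\vec\delta\rangle\rho\,\|\,\langle\vec\gamma\rangle\sigma\to^*\langle\vec\delta_i\rangle\rho_i\,\|\,\langle\vec\gamma_i\rangle\sigma_i$ via a reduction in which rule (rbk) is never used.
   Context: Retractable contracts: closed expressions of $\sigma ::= \mathbf 1 \mid \sum_{i\in I} a_i.\sigma_i \mid \sum_{i\in I}\overline a_i.\sigma_i \mid \bigoplus_{i\in I}\overline a_i.\sigma_i \mid x \mid \mathsf{rec}\,x.\sigma$ over names $a$ and conames $\overline a$, $I$ non-empty finite, pairwise distinct (co)names per choice, $\sigma$ not a variable in $\mathsf{rec}\,x.\sigma$; equi-recursive, choices commutative, unary outputs of both kinds identified; $\alpha$ ranges over names and conames, $\overline{\overline a}=a$. Histories: $\vec\gamma::=[\,]\mid\vec\gamma:\sigma$ with $\sigma$ a contract or the symbol $\circ$. LTS on $\langle\vec\gamma\rangle\sigma$: $\langle\vec\gamma\rangle(\alpha.\sigma+\sigma')\xrightarrow{\alpha}\langle\vec\gamma:\sigma'\rangle\sigma$; $\langle\vec\gamma\rangle(\overline a.\sigma\oplus\sigma')\xrightarrow{\tau}\langle\vec\gamma\rangle\overline a.\sigma$;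 $\langle\vec\gamma\rangle\alpha.\sigma\xrightarrow{\alpha}\langle\vec\gamma:\circ\rangle\sigma$; $\langle\vec\gamma:\sigma'\rangle\sigma\xrightarrow{\mathsf{rb}}\langle\vec\gamma\rangle\sigma'$. Pair reduction: (comm) synchronisation of complementary actions $\alpha,\overline\alpha$ of client and server; ($\tau$) a $\tau$-step of either side; (rbk) simultaneous $\mathsf{rb}$-steps of both sides when the client's current contract is not $\mathbf 1$, allowed only when neither (comm) nor ($\tau$) applies. Formal system (judgments $\Gamma\rhd\rho\dashv\sigma$, $\Gamma$ a set of $\rho'\dashv\sigma'$): (Ax) $\Gamma\rhd\mathbf 1\dashv\sigma$; (Hyp) $\Gamma,\rho\dashv\sigma\rhd\rho\dashv\sigma$; (+,+) from $\Gamma,\alpha.\rho+\rho'\dashv\overline\alpha.\sigma+\sigma'\rhd\rho\dashv\sigma$ infer $\Gamma\rhd\alpha.\rho+\rho'\dashv\overline\alpha.\sigma+\sigma'$; $(\oplus,+)$ from $\Gamma,\bigoplus_{i\in I}\overline a_i.\rho_i\dashv\sum_{j\in I\cup J}a_j.\sigma_j\rhd\rho_i\dashv\sigma_i$ ($\forall i\in I$) infer $\Gamma\rhd\bigoplus_{i\in I}\overline a_i.\rho_i\dashv\sum_{j\in I\cup J}a_j.\sigma_j$; $(+,\oplus)$ symmetric: from $\Gamma,\sum_{j\in I\cup J}a_j.\sigma_j\dashv\bigoplus_{i\in I}\overline a_i.\rho_i\rhd\rho_i\dashv\sigma_i$ ($\forall i\in I$) infer $\Gamma\rhd\sum_{j\in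 I\cup J}a_j.\sigma_j\dashv\bigoplus_{i\in I}\overline a_i.\rho_i$ (here the pair of the premises is $\sigma_i$ as client-side continuation component paired appropriately). -}

module Defs where

open import Data.Nat using (ℕ; suc)
open import Data.Fin using (Fin; zero; suc)
open import Data.List using (List; []; _∷_; map)
open import Data.List.Relation.Unary.Unique.Propositional using (Unique)
open import Data.Maybe using (Maybe; just; nothing)
open import Data.Product using (_×_; _,_; ∃)
open import Data.Unit using (⊤)
open import Data.Empty using (⊥)
open import Relation.Nullary using (¬_)
open import Relation.Binary.Construct.Closure.ReflexiveTransitive using (Star)

Name : Set
Name = ℕ

data Act : Set where
  inA  : Name → Act
  outA : Name → Act

co : Act → Act
co (inA a)  = outA a
co (outA a) = inA a

-- Contract terms (de Bruijn; Con n has n free recursion variables)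
--   inp bs : Σ a_i.σ_i     out bs : Σ ā_i.σ_i     sel bs : ⊕ ā_i.σ_i
-- Brs n : non-empty finite list of branches (a_i , σ_i)

mutual
  data Con (n : ℕ) : Set where
    𝟏   : Con n
    inp : Brs n → Con n
    out : Brs n → Con n
    sel : Brs n → Con n
    var : Fin n → Con n
    rec : Con (suc n) → Con n

  data Brs (n : ℕ) : Set where
    one  : Name → Con n → Brs n
    cons : Name → Con n → Brs n → Brs n

liftR : ∀ {n m} → (Fin n → Fin m) → Fin (suc n) → Fin (suc m)
liftR f zero    = zero
liftR f (suc i) = suc (f i)

mutual
  ren : ∀ {n m} → (Fin n → Fin m) → Con n → Con m
  ren f 𝟏        = 𝟏
  ren f (inp bs) = inp (renB f bs)
  ren f (out bs) = out (renB f bs)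
  ren f (sel bs) = sel (renB f bs)
  ren f (var i)  = var (f i)
  ren f (rec t)  = rec (ren (liftR f) t)

  renB : ∀ {n m} → (Fin n → Fin m) → Brs n → Brs m
  renB f (one a t)     = one a (ren f t)
  renB f (cons a t bs) = cons a (ren f t) (renB f bs)

liftS : ∀ {n m} → (Fin n → Con m) → Fin (suc n) → Con (suc m)
liftS s zero    = var zero
liftS s (suc i) = ren suc (s i)

mutual
  sub : ∀ {n m} → (Fin n → Con m) → Con n → Con m
  sub s 𝟏        = 𝟏
  sub s (inp bs) = inp (subB s bs)
  sub s (out bs) = out (subB s bs)
  sub s (sel bs) = sel (subB s bs)
  sub s (var i)  = s i
  sub s (rec t)  = rec (sub (liftS s) t)

  subB : ∀ {n m} → (Fin n → Con m) → Brs n → Brs m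
  subB s (one a t)     = one a (sub s t)
  subB s (cons a t bs) = cons a (sub s t) (subB s bs)

unfold : Con 1 → Con 0
unfold b = sub σ b
  where
  σ : Fin 1 → Con 0
  σ zero = rec b

names : ∀ {n} → Brs n → List Name
names (one a _)     = a ∷ []
names (cons a _ bs) = a ∷ names bs

NotVar : ∀ {n} → Con n → Set
NotVar (var _) = ⊥
NotVar _       = ⊤

mutual
  WF : ∀ {n} → Con n → Set
  WF 𝟏        = ⊤
  WF (inp bs) = Unique (names bs) × WFB bs
  WF (out bs) = Unique (names bs) × WFB bs
  WF (sel bs) = Unique (names bs) × WFB bs
  WF (var _)  = ⊤
  WF (rec t)  = NotVar t × WF t

  WFB : ∀ {n} → Brs n → Set
  WFB (one _ t)     = WF t
  WFB (cons _ t bs) = WF t × WFB bs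

-- Contracts are closed well-formed terms Con 0.

-- Equi-recursion: head unfolding of rec

data Unf : Con 0 → Con 0 → Set where
  here : ∀ {t} → Unf t t
  step : ∀ {b t} → Unf (unfold b) t → Unf (rec b) t

-- Commutativity of choice: Pick bs a c r  means that the choice bs is
-- a.c + rest (r = just rest) or the unary a.c (r = nothing).
data Pick {n : ℕ} : Brs n → Name → Con n → Maybe (Brs n) → Set where
  here1  : ∀ {a c} → Pick (one a c) a c nothing
  here   : ∀ {a c bs} → Pick (cons a c bs) a c (just bs)
  there1 : ∀ {a c b d bs} → Pick bs a c nothing →
           Pick (cons b d bs) a c (just (one b d))
  there  : ∀ {a c b d bs r} → Pick bs a c (just r) →
           Pick (cons b d bs) a c (just (cons b d r))

data HEntry : Set where
  ∘   : HEntry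
  ⌜_⌝ : Con 0 → HEntry

-- most recent entry at the head of the list:  γ⃗ : σ  is  σ ∷ γ⃗
History : Set
History = List HEntry

Proc : Set
Proc = History × Con 0

data Lbl : Set where
  act : Act → Lbl
  τ   : Lbl
  rb  : Lbl

restEntry : (Brs 0 → Con 0) → Maybe (Brs 0) → HEntry
restEntry k nothing  = ∘
restEntry k (just r) = ⌜ k r ⌝

data _—[_]→_ : Proc → Lbl → Proc → Set where
  -- ⟨γ⟩(α.σ + σ') → ⟨γ:σ'⟩σ   and   ⟨γ⟩α.σ → ⟨γ:∘⟩σ
  ext-in  : ∀ {γ t bs a c r} → Unf t (inp bs) → Pick bs a c r →
            (γ , t) —[ act (inA a) ]→ (restEntry inp r ∷ γ , c)
  ext-out : ∀ {γ t bs a c r} → Unf t (out bs) → Pick bs a c r →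
            (γ , t) —[ act (outA a) ]→ (restEntry out r ∷ γ , c)
  int-τ   : ∀ {γ t bs a c r} → Unf t (sel bs) → Pick bs a c (just r) →
            (γ , t) —[ τ ]→ (γ , out (one a c))
  -- unary ⊕ ā.σ is identified with the unary output ā.σ
  int-1   : ∀ {γ t a c} → Unf t (sel (one a c)) →
            (γ , t) —[ act (outA a) ]→ (∘ ∷ γ , c)
  rollback : ∀ {γ s t} → (⌜ s ⌝ ∷ γ , t) —[ rb ]→ (γ , s)

-- Client/server pairs ⟨δ⟩ρ ∥ ⟨γ⟩σ

Cfg : Set
Cfg = Proc × Proc

data _⟶ᶜ_ : Cfg → Cfg → Set where
  comm : ∀ {P P' Q Q' α} → P —[ act α ]→ P' → Q —[ act (co α) ]→ Q' →
         (P , Q) ⟶ᶜ (P' , Q')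
  τL   : ∀ {P P' Q} → P —[ τ ]→ P' → (P , Q) ⟶ᶜ (P' , Q)
  τR   : ∀ {P Q Q'} → Q —[ τ ]→ Q' → (P , Q) ⟶ᶜ (P , Q')

data _⟶_ : Cfg → Cfg → Set where
  nonrbk : ∀ {s s'} → s ⟶ᶜ s' → s ⟶ s'
  rbk    : ∀ {δ ρ γ σ P' Q'} → ¬ Unf ρ 𝟏 →
           (∀ s' → ¬ (((δ , ρ) , (γ , σ)) ⟶ᶜ s')) →
           (δ , ρ) —[ rb ]→ P' → (γ , σ) —[ rb ]→ Q' →
           ((δ , ρ) , (γ , σ)) ⟶ (P' , Q')

_⟶ᶜ*_ : Cfg → Cfg → Set
_⟶ᶜ*_ = Star _⟶ᶜ_

Ctx : Set
Ctx = List (Con 0 × Con 0)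

record Judgment : Set where
  constructor _▹_⊣_
  field
    ctx    : Ctx
    client : Con 0
    server : Con 0
open Judgment public

data Pol : Set where
  input output : Pol

toAct : Pol → Name → Act
toAct input  a = inA a
toAct output a = outA a

dualP : Pol → Pol
dualP input  = output
dualP output = input

-- t is (up to unfolding / identification of unary outputs) an external
-- choice of polarity p with branches bs
data ExtCh (t : Con 0) : Pol → Brs 0 → Set where
  ext-inp : ∀ {bs} → Unf t (inp bs) → ExtCh t input bs
  ext-out : ∀ {bs} → Unf t (out bs) → ExtCh t output bs
  ext-sel1 : ∀ {a c} → Unf t (sel (one a c)) → ExtCh t output (one a c)

-- t is (up to unfolding / identification of unary outputs) an internal
-- choice ⊕ with branches bs
data IntCh (t : Con 0) : Brs 0 → Set where
  int-sel  : ∀ {bs} → Unf t (sel bs) → IntCh t bs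
  int-out1 : ∀ {a c} → Unf t (out (one a c)) → IntCh t (one a c)

-- Match bs cs ps : for every branch ā_i.ρ_i of bs (i ∈ I), cs has a
-- branch a_i.σ_i (so I ⊆ I ∪ J), and ps lists the pairs (ρ_i , σ_i)
data Match : Brs 0 → Brs 0 → List (Con 0 × Con 0) → Set where
  m1 : ∀ {a r s cs rest} → Pick cs a s rest →
       Match (one a r) cs ((r , s) ∷ [])
  mc : ∀ {a r s cs rest bs ps} → Pick cs a s rest → Match bs cs ps →
       Match (cons a r bs) cs ((r , s) ∷ ps)

swapP : Con 0 × Con 0 → Con 0 × Con 0
swapP (x , y) = (y , x)

data RuleInst (Γ : Ctx) (ρ σ : Con 0) : List Judgment → Set where
  -- (+,+) : ρ = α.ρ₁ + ρ' , σ = ᾱ.σ₁ + σ'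
  r++ : ∀ {p bs cs a ρ₁ σ₁ r r'} →
        ExtCh ρ p bs → Pick bs a ρ₁ r →
        ExtCh σ (dualP p) cs → Pick cs a σ₁ r' →
        RuleInst Γ ρ σ ((((ρ , σ) ∷ Γ) ▹ ρ₁ ⊣ σ₁) ∷ [])
  -- (⊕,+) : ρ = ⊕_{i∈I} ā_i.ρ_i , σ = Σ_{j∈I∪J} a_j.σ_j ; premises ρ_i ⊣ σ_i
  r⊕+ : ∀ {bs cs ps} →
        IntCh ρ bs → ExtCh σ input cs → Match bs cs ps →
        RuleInst Γ ρ σ
          (map (λ q → ((ρ , σ) ∷ Γ) ▹ Data.Product.proj₁ q ⊣ Data.Product.proj₂ q) ps)
  -- (+,⊕) : ρ = Σ_{j∈I∪J} a_j.σ_j , σ = ⊕_{i∈I} ā_i.ρ_i ;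
  -- premises (client σ_i) ⊣ (server ρ_i)
  r+⊕ : ∀ {bs cs ps} →
        ExtCh ρ input cs → IntCh σ bs → Match bs cs ps →
        RuleInst Γ ρ σ
          (map (λ q → ((ρ , σ) ∷ Γ) ▹ Data.Product.proj₂ q ⊣ Data.Product.proj₁ q) ps)

-- Each rule makes the pair commit to the premise's branch without rolling back:
-- (+,+) is one synchronisation of the chosen actions, while in (⊕,+) and (+,⊕)
-- the internal choice first resolves by at most one τ-step to the output of the
-- chosen branch, which the external choice on the other side can receive since
-- its branches include every branch of the internal one.
module Submission where

open import Defs
open import Data.List using (List; _∷_)
open import Data.List.Membership.Propositional using (_∈_)
open import Data.List.Membership.Propositional.Properties using (∈-map⁻)
open import Data.List.Relation.Unary.All using (All)
open import Data.List.Relation.Unary.Any using (here; there)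
open import Data.Maybe using (Maybe; just; nothing)
open import Data.Product using (_×_; _,_; ∃; ∃₂; proj₁; proj₂)
open import Relation.Binary.PropositionalEquality using (_≡_; refl; sym; subst)
open import Relation.Binary.Construct.Closure.ReflexiveTransitive using (Star; ε; _◅_; _◅◅_; gmap)

co-toAct : ∀ p a → co (toAct p a) ≡ toAct (dualP p) a
co-toAct input  a = refl
co-toAct output a = refl

Match-pick : ∀ {bs cs ps r s} → Match bs cs ps → (r , s) ∈ ps →
  ∃ λ a → ∃₂ λ (x y : Maybe (Brs 0)) → Pick bs a r x × Pick cs a s y
Match-pick (m1 pc)   (here refl) = _ , _ , _ , here1 , pc
Match-pick (mc pc m) (here refl) = _ , _ , _ , here , pc
Match-pick (mc pc m) (there k) with Match-pick m k
... | a , nothing , y , pb , pc′ = a , _ , y , there1 pb , pc′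
... | a , just _  , y , pb , pc′ = a , _ , y , there pb , pc′

ExtCh-step : ∀ {δ t p bs a c x} → ExtCh t p bs → Pick bs a c x →
  ∃ λ h → (δ , t) —[ act (toAct p a) ]→ (h ∷ δ , c)
ExtCh-step (ext-inp u)  pk    = _ , ext-in u pk
ExtCh-step (ext-out u)  pk    = _ , ext-out u pk
ExtCh-step (ext-sel1 u) here1 = _ , int-1 u

_—τ→*_ : Proc → Proc → Set
_—τ→*_ = Star (λ P Q → P —[ τ ]→ Q)

IntCh-commit : ∀ {δ t bs a c x} → IntCh t bs → Pick bs a c x →
  ∃ λ t′ → (δ , t) —τ→* (δ , t′) × (δ , t′) —[ act (outA a) ]→ (∘ ∷ δ , c)
IntCh-commit (int-sel u)  here1 = _ , ε , int-1 u
IntCh-commit {x = just _} (int-sel u) pk = _ , int-τ u pk ◅ ε , ext-out here here1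
IntCh-commit (int-out1 u) here1 = _ , ε , ext-out u here1

IntCh-client-commit : ∀ {δ t bs a c x Q Q′} → IntCh t bs → Pick bs a c x →
  Q —[ act (inA a) ]→ Q′ → ((δ , t) , Q) ⟶ᶜ* ((∘ ∷ δ , c) , Q′)
IntCh-client-commit ic pk q with IntCh-commit ic pk
... | _ , τs , o = gmap (_, _) τL τs ◅◅ comm o q ◅ ε

IntCh-server-commit : ∀ {γ t bs a c x P P′} → IntCh t bs → Pick bs a c x →
  P —[ act (inA a) ]→ P′ → (P , (γ , t)) ⟶ᶜ* (P′ , (∘ ∷ γ , c))
IntCh-server-commit ic pk q with IntCh-commit ic pk
... | _ , τs , o = gmap (_ ,_) τR τs ◅◅ comm q o ◅ ε

mainTheorem3 : (Γ : Ctx) (ρ σ : Con 0) (prems : List Judgment) →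
    All (λ p → WF (proj₁ p) × WF (proj₂ p)) Γ → WF ρ → WF σ →
    RuleInst Γ ρ σ prems →
    (δ γ : History) → (J : Judgment) → J ∈ prems →
    ∃₂ λ (δᵢ γᵢ : History) →
      ((δ , ρ) , (γ , σ)) ⟶ᶜ* ((δᵢ , client J) , (γᵢ , server J))
mainTheorem3 Γ ρ σ _ _ _ _ (r++ {p = p} {a = a} eρ pρ eσ pσ) δ γ J (here refl)
  with ExtCh-step {δ = δ} eρ pρ | ExtCh-step {δ = γ} eσ pσ
... | _ , sρ | _ , sσ =
  _ , _ , comm sρ (subst (λ α → _ —[ act α ]→ _) (sym (co-toAct p a)) sσ) ◅ ε
mainTheorem3 Γ ρ σ _ _ _ _ (r⊕+ ic ec m) δ γ J k with ∈-map⁻ _ k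
... | _ , k′ , refl with Match-pick m k′
... | _ , _ , _ , pb , pc =
  _ , _ , IntCh-client-commit ic pb (proj₂ (ExtCh-step ec pc))
mainTheorem3 Γ ρ σ _ _ _ _ (r+⊕ ec ic m) δ γ J k with ∈-map⁻ _ k
... | _ , k′ , refl with Match-pick m k′
... | _ , _ , _ , pb , pc =
  _ , _ , IntCh-server-commit ic pb (proj₂ (ExtCh-step ec pc))
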